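{- Let $G$ be a permutation graph and let $\overline{G}$ denote its complement. Then $t(G) \leq \chi(\overline{G}) = \omega(\overline{G}) = \alpha(G)$.
   Context: A graph $G=(V,E)$ is a threshold graph if there exist non-negative reals $w_v$ ($v\in V$) and $t$ such that for every $U\subseteq V$, $\sum_{v\in U} w_v \le t$ if and only if $U$ is a stable (independent) set. The threshold dimension $t(G)$ of a graph $G$ is the least integer $k$ such that there are threshold graphs $T_1,\dots,T_k$ with $V(T_i)=V(G)$ for all $i$ and $E(G)=E(T_1)\cup\cdots\cup E(T_k)$. For a permutation $\Pi$ of $\{1,\dots,n\}$, the graph $G[\Pi]$ has vertex set $\{1,\dots,n\}$ and $i,j$ adjacent iff $(i-j)(\Pi^{ -1}(i)-\Pi^{ -1}(j))<0$; a graph is a permutation graph if it is isomorphic to $G[\Pi]$ for some permutation $\Pi$. $\alpha$, $\omega$, $\chi$ denote independence number, clique number and chromatic number. -}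

module Defs where

open import Data.Nat using (ℕ; _≤_; _<ᵇ_)
open import Data.Bool using (Bool; true; false; not; _∧_; _∨_; if_then_else_)
open import Data.Bool.Properties using (∧-comm)
open import Data.Fin using (Fin; zero; suc; toℕ; _≟_)
open import Data.Fin.Subset using (Subset; _∈_; ∣_∣)
open import Data.Fin.Permutation using (Permutation′; _⟨$⟩ʳ_; _⟨$⟩ˡ_)
open import Data.Vec using ([]; _∷_)
open import Data.Rational as ℚ using (ℚ; 0ℚ)
open import Data.Product using (Σ; ∃; _×_; _,_)
open import Relation.Nullary using (¬_; yes; no)
open import Relation.Nullary.Decidable using (⌊_⌋)
open import Relation.Binary.PropositionalEquality using (_≡_; _≢_; refl; sym; cong₂)
open import Function.Bundles using (_⇔_)

record SimpleGraph (n : ℕ) : Set where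
  field
    adj    : Fin n → Fin n → Bool
    adj-sym : ∀ i j → adj i j ≡ adj j i
    irrefl : ∀ i → adj i i ≡ false
open SimpleGraph public

Adj : ∀ {n} → SimpleGraph n → Fin n → Fin n → Set
Adj G i j = adj G i j ≡ true

private
  neq : ∀ {n} (i j : Fin n) → Bool
  neq i j = not ⌊ i ≟ j ⌋

  neq-sym : ∀ {n} (i j : Fin n) → neq i j ≡ neq j i
  neq-sym i j with i ≟ j | j ≟ i
  ... | yes _ | yes _ = refl
  ... | no _  | no _  = refl
  ... | yes p | no q  with q (sym p)
  ... | ()
  neq-sym i j | no q | yes p with q (sym p)
  ... | ()

  neq-refl : ∀ {n} (i : Fin n) → neq i i ≡ false
  neq-refl i with i ≟ i
  ... | yes _ = refl
  ... | no q with q refl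
  ... | ()

complement : ∀ {n} → SimpleGraph n → SimpleGraph n
complement G = record
  { adj    = λ i j → not (adj G i j) ∧ neq i j
  ; adj-sym = λ i j → cong₂ (λ a b → not a ∧ b) (SimpleGraph.adj-sym G i j) (neq-sym i j)
  ; irrefl = λ i → helper (not (adj G i i)) (neq-refl i)
  }
  where
    helper : ∀ {n} {i : Fin n} (a : Bool) → neq i i ≡ false → a ∧ neq i i ≡ false
    helper {i = i} a e with neq i i
    helper false refl | .false = refl
    helper true  refl | .false = refl

IsStable : ∀ {n} → SimpleGraph n → Subset n → Set
IsStable G U = ∀ i j → i ∈ U → j ∈ U → ¬ Adj G i j

IsClique : ∀ {n} → SimpleGraph n → Subset n → Set
IsClique G U = ∀ i j → i ∈ U → j ∈ U → i ≢ j → Adj G i j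

IsProperColouring : ∀ {n} (G : SimpleGraph n) (k : ℕ) → (Fin n → Fin k) → Set
IsProperColouring G k c = ∀ i j → Adj G i j → c i ≢ c j

IsIndependenceNumber : ∀ {n} → SimpleGraph n → ℕ → Set
IsIndependenceNumber G a =
  (∃ λ U → IsStable G U × ∣ U ∣ ≡ a) × (∀ U → IsStable G U → ∣ U ∣ ≤ a)

IsCliqueNumber : ∀ {n} → SimpleGraph n → ℕ → Set
IsCliqueNumber G a =
  (∃ λ U → IsClique G U × ∣ U ∣ ≡ a) × (∀ U → IsClique G U → ∣ U ∣ ≤ a)

IsChromaticNumber : ∀ {n} → SimpleGraph n → ℕ → Set
IsChromaticNumber {n} G a =
  (Σ (Fin n → Fin a) λ c → IsProperColouring G a c)
  × (∀ k (c : Fin n → Fin k) → IsProperColouring G k c → a ≤ k)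

sumOver : ∀ {n} → (Fin n → ℚ) → Subset n → ℚ
sumOver w [] = 0ℚ
sumOver w (b ∷ U) = (if b then w zero else 0ℚ) ℚ.+ sumOver (λ i → w (suc i)) U

IsThreshold : ∀ {n} → SimpleGraph n → Set
IsThreshold {n} T =
  Σ (Fin n → ℚ) λ w → Σ ℚ λ t →
    (∀ v → 0ℚ ℚ.≤ w v) × (0ℚ ℚ.≤ t) ×
    (∀ U → (sumOver w U ℚ.≤ t) ⇔ IsStable T U)

IsThresholdCover : ∀ {n} → SimpleGraph n → (k : ℕ) → (Fin k → SimpleGraph n) → Set
IsThresholdCover G k T =
  (∀ l → IsThreshold (T l)) × (∀ i j → Adj G i j ⇔ (∃ λ l → Adj (T l) i j))

-- t(G) ≤ a : the least k admitting a threshold cover is ≤ a,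
-- i.e. some k ≤ a admits a threshold cover.
ThresholdDimensionAtMost : ∀ {n} → SimpleGraph n → ℕ → Set
ThresholdDimensionAtMost {n} G a =
  ∃ λ k → k ≤ a × Σ (Fin k → SimpleGraph n) λ T → IsThresholdCover G k T

-- The graph G[Π] on Fin n (vertices 0..n-1 instead of 1..n):
-- i ~ j iff (i - j)(Π⁻¹(i) - Π⁻¹(j)) < 0.
permAdj : ∀ {n} → Permutation′ n → Fin n → Fin n → Bool
permAdj Π i j =
  ((toℕ i <ᵇ toℕ j) ∧ (toℕ (Π ⟨$⟩ˡ j) <ᵇ toℕ (Π ⟨$⟩ˡ i)))
  ∨ ((toℕ j <ᵇ toℕ i) ∧ (toℕ (Π ⟨$⟩ˡ i) <ᵇ toℕ (Π ⟨$⟩ˡ j)))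

IsPermutationGraph : ∀ {n} → SimpleGraph n → Set
IsPermutationGraph {n} G =
  Σ (Permutation′ n) λ Π → Σ (Permutation′ n) λ σ →
    ∀ i j → adj G i j ≡ permAdj Π (σ ⟨$⟩ʳ i) (σ ⟨$⟩ʳ j)

-- Write G as the inversion graph of the points (p u, x u), with distinct coordinates: u and v
-- are adjacent iff p and x order them oppositely.  Non-adjacent vertices are then comparable in
-- the dominance order ≺, so colouring each vertex by the length of the longest ≺-chain below it
-- properly colours the complement, and a longest chain is a clique of the complement (a stable
-- set of G) meeting every colour: χ(Ḡ) = ω(Ḡ) = α(G).  Each colour class is a clique of G; giving
-- every edge to the class of its endpoint that comes first in p yields one split graph per class
-- with nested neighbourhoods, i.e. a threshold graph, so t(G) ≤ α(G).
module Submission where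

open import Defs
open import Data.Bool using (true; false; if_then_else_; T; _∧_; _∨_)
import Data.Bool.Properties as Bool
open import Data.Fin using (Fin; zero; suc; toℕ; fromℕ<; punchOut; _≟_)
import Data.Fin.Properties as Fin
open import Data.Fin.Permutation using (Permutation′; _⟨$⟩ʳ_; flip; _∘ₚ_)
open import Data.Fin.Subset using (Subset; _∈_; _⊂_; ∣_∣; _∪_; ⁅_⁆; ⊥)
open import Data.Fin.Subset.Properties
  using (_∈?_; x∈⁅x⁆; x∈⁅y⁆⇒x≡y; ∣⁅x⁆∣≡1; ∉⊥; p⊆p∪q; x∈p∪q⁺; x∈p∪q⁻; p⊂q⇒∣p∣<∣q∣)
open import Data.Nat using (ℕ; zero; suc; _+_; _*_; _∸_; _^_; _≤_; _<_; _<ᵇ_; _⊔_; _⊓_; z≤n; s≤s; _≤?_; _<?_)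
import Data.Nat.Properties as ℕ
open import Data.Product using (∃; _×_; _,_; proj₁; proj₂)
open import Data.Product.Function.NonDependent.Propositional using (_×-⇔_)
open import Data.Rational as ℚ using (ℚ; 0ℚ; 1ℚ)
import Data.Rational.Properties as ℚ
open import Data.Sum using (_⊎_; inj₁; inj₂; [_,_]; map₂; swap)
open import Data.Sum.Function.Propositional using (_⊎-⇔_)
open import Data.Vec using (_∷_; []; here; there)
open import Function using (_∘_)
open import Function.Bundles using (_⇔_; mk⇔; Equivalence; Injection)
open import Function.Construct.Composition using (_⇔-∘_)
open import Function.Construct.Symmetry using (⇔-sym)
open import Function.Properties.Inverse using (↔⇒↣)
open import Relation.Binary using (tri<; tri≈; tri>)
open import Relation.Binary.PropositionalEquality hiding ([_])
open import Relation.Nullary using (¬_; Dec; yes; no; does; contradiction)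
open import Relation.Nullary.Decidable using (_×-dec_; _⊎-dec_; dec-false; does-⇔)

open Equivalence using (to; from)

fromℕ : ℕ → ℚ
fromℕ zero    = 0ℚ
fromℕ (suc k) = 1ℚ ℚ.+ fromℕ k

fromℕ-+ : ∀ a b → fromℕ (a + b) ≡ fromℕ a ℚ.+ fromℕ b
fromℕ-+ zero    b = sym (ℚ.+-identityˡ (fromℕ b))
fromℕ-+ (suc a) b = trans (cong (1ℚ ℚ.+_) (fromℕ-+ a b)) (sym (ℚ.+-assoc 1ℚ (fromℕ a) (fromℕ b)))

fromℕ-nonNeg : ∀ k → 0ℚ ℚ.≤ fromℕ k
fromℕ-nonNeg zero    = ℚ.≤-refl
fromℕ-nonNeg (suc k) = subst (ℚ._≤ fromℕ (suc k)) (ℚ.+-identityˡ 0ℚ)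
  (ℚ.+-mono-≤ (ℚ.nonNegative⁻¹ 1ℚ) (fromℕ-nonNeg k))

fromℕ-mono-≤ : ∀ {a b} → a ≤ b → fromℕ a ℚ.≤ fromℕ b
fromℕ-mono-≤ {b = b} z≤n = fromℕ-nonNeg b
fromℕ-mono-≤ (s≤s a≤b)   = ℚ.+-monoʳ-≤ 1ℚ (fromℕ-mono-≤ a≤b)

fromℕ-<-suc : ∀ k → fromℕ k ℚ.< fromℕ (suc k)
fromℕ-<-suc k = subst (ℚ._< fromℕ (suc k)) (ℚ.+-identityˡ (fromℕ k))
  (ℚ.+-monoˡ-< (fromℕ k) (ℚ.positive⁻¹ 1ℚ))

fromℕ-cancel-≤ : ∀ {a b} → fromℕ a ℚ.≤ fromℕ b → a ≤ b
fromℕ-cancel-≤ {a} {b} fa≤fb with a ≤? b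
... | yes a≤b = a≤b
... | no  a≰b = contradiction
  (ℚ.<-≤-trans (fromℕ-<-suc b) (ℚ.≤-trans (fromℕ-mono-≤ (ℕ.≰⇒> a≰b)) fa≤fb)) (ℚ.<-irrefl refl)

sumℕ : ∀ {m} → (Fin m → ℕ) → Subset m → ℕ
sumℕ w []      = 0
sumℕ w (b ∷ U) = (if b then w zero else 0) + sumℕ (w ∘ suc) U

sumOver-fromℕ : ∀ {m} (w : Fin m → ℕ) U → sumOver (fromℕ ∘ w) U ≡ fromℕ (sumℕ w U)
sumOver-fromℕ w []          = refl
sumOver-fromℕ w (true ∷ U)  = trans (cong (fromℕ (w zero) ℚ.+_) (sumOver-fromℕ (w ∘ suc) U))
                                    (sym (fromℕ-+ (w zero) _))
sumOver-fromℕ w (false ∷ U) = trans (cong (0ℚ ℚ.+_) (sumOver-fromℕ (w ∘ suc) U))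
                                    (ℚ.+-identityˡ _)

sum≤card*bound : ∀ {m} (w : Fin m → ℕ) U {b} → (∀ {i} → i ∈ U → w i ≤ b) → sumℕ w U ≤ m * b
sum≤card*bound w []          bound = z≤n
sum≤card*bound w (true ∷ U)  bound = ℕ.+-mono-≤ (bound here) (sum≤card*bound (w ∘ suc) U (bound ∘ there))
sum≤card*bound w (false ∷ U) {b} bound =
  ℕ.≤-trans (sum≤card*bound (w ∘ suc) U (bound ∘ there)) (ℕ.m≤n+m _ b)

member≤sum : ∀ {m} (w : Fin m → ℕ) U {i} → i ∈ U → w i ≤ sumℕ w U
member≤sum w (true ∷ U) here      = ℕ.m≤m+n _ _
member≤sum w (b ∷ U)    (there i∈U) = ℕ.≤-trans (member≤sum (w ∘ suc) U i∈U) (ℕ.m≤n+m _ _)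

pair≤sum : ∀ {m} (w : Fin m → ℕ) U {i j} → i ∈ U → j ∈ U → i ≢ j → w i + w j ≤ sumℕ w U
pair≤sum w (true ∷ U) here        here        i≢j = contradiction refl i≢j
pair≤sum w (true ∷ U) here        (there j∈U) _   = ℕ.+-monoʳ-≤ (w zero) (member≤sum (w ∘ suc) U j∈U)
pair≤sum w (true ∷ U) {i = suc i} (there i∈U) here _ = begin
  w (suc i) + w zero     ≡⟨ ℕ.+-comm (w (suc i)) (w zero) ⟩
  w zero + w (suc i)     ≤⟨ ℕ.+-monoʳ-≤ (w zero) (member≤sum (w ∘ suc) U i∈U) ⟩
  sumℕ w (true ∷ U)      ∎
  where open ℕ.≤-Reasoning
pair≤sum w (b ∷ U) (there i∈U) (there j∈U) i≢j =
  ℕ.≤-trans (pair≤sum (w ∘ suc) U i∈U j∈U (i≢j ∘ cong suc)) (ℕ.m≤n+m _ _)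

sum≤member+card*bound : ∀ {m} (w : Fin m → ℕ) U {z b} → z ∈ U →
  (∀ {i} → i ∈ U → i ≢ z → w i ≤ b) → sumℕ w U ≤ w z + m * b
sum≤member+card*bound w (true ∷ U) {b = b} here bound = ℕ.+-monoʳ-≤ (w zero)
  (ℕ.≤-trans (sum≤card*bound (w ∘ suc) U (λ i∈U → bound (there i∈U) λ ())) (ℕ.m≤n+m _ b))
sum≤member+card*bound {suc m} w (true ∷ U) {suc z} {b} (there z∈U) bound = begin
  w zero + sumℕ (w ∘ suc) U        ≤⟨ ℕ.+-mono-≤ (bound here λ ()) IH ⟩
  b + (w (suc z) + m * b)          ≡⟨ ℕ.+-comm b _ ⟩
  (w (suc z) + m * b) + b          ≡⟨ ℕ.+-assoc (w (suc z)) (m * b) b ⟩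
  w (suc z) + (m * b + b)          ≡⟨ cong (w (suc z) +_) (ℕ.+-comm (m * b) b) ⟩
  w (suc z) + suc m * b            ∎
  where
  open ℕ.≤-Reasoning
  IH = sum≤member+card*bound (w ∘ suc) U z∈U (λ i∈U i≢z → bound (there i∈U) (i≢z ∘ Fin.suc-injective))
sum≤member+card*bound {suc m} w (false ∷ U) {suc z} {b} (there z∈U) bound = ℕ.≤-trans
  (sum≤member+card*bound (w ∘ suc) U z∈U (λ i∈U i≢z → bound (there i∈U) (i≢z ∘ Fin.suc-injective)))
  (ℕ.+-monoʳ-≤ (w (suc z)) (ℕ.m≤n+m _ b))

maxOver : ∀ {m} → (Fin m → ℕ) → ℕ
maxOver {zero}  h = 0
maxOver {suc m} h = h zero ⊔ maxOver (h ∘ suc)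

≤-maxOver : ∀ {m} (h : Fin m → ℕ) i → h i ≤ maxOver h
≤-maxOver h zero    = ℕ.m≤m⊔n _ _
≤-maxOver h (suc i) = ℕ.≤-trans (≤-maxOver (h ∘ suc) i) (ℕ.m≤n⊔m (h zero) _)

maxOver-cong : ∀ {m} {h g : Fin m → ℕ} → (∀ i → h i ≡ g i) → maxOver h ≡ maxOver g
maxOver-cong {zero}  h≗g = refl
maxOver-cong {suc m} h≗g = cong₂ _⊔_ (h≗g zero) (maxOver-cong (h≗g ∘ suc))

maxOver-attained : ∀ {m} (h : Fin m → ℕ) {k} → maxOver h ≡ suc k → ∃ λ i → h i ≡ suc k
maxOver-attained {zero}  h ()
maxOver-attained {suc m} h eq with ℕ.⊔-sel (h zero) (maxOver (h ∘ suc))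
... | inj₁ ⊔≡h₀ = zero , trans (sym ⊔≡h₀) eq
... | inj₂ ⊔≡rest with maxOver-attained (h ∘ suc) (trans (sym ⊔≡rest) eq)
...   | i , hi≡ = suc i , hi≡

if-does-yes : ∀ {A : Set} (d : Dec A) {a b : ℕ} → A → (if does d then a else b) ≡ a
if-does-yes (yes _) _   = refl
if-does-yes (no ¬A) a∈ = contradiction a∈ ¬A

if-does-cong : ∀ {A : Set} (d : Dec A) {a b c : ℕ} → (A → a ≡ b) →
  (if does d then a else c) ≡ (if does d then b else c)
if-does-cong (yes A) a≡b = a≡b A
if-does-cong (no  _) _   = refl

if-does-≡suc : ∀ {A : Set} (d : Dec A) {a k : ℕ} → (if does d then a else 0) ≡ suc k → A × a ≡ suc k
if-does-≡suc (yes A) a≡ = A , a≡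
if-does-≡suc (no  _) ()

∣∣≤-injection : ∀ {m k} (U : Subset m) (f : ∀ {i} → i ∈ U → Fin k) →
  (∀ {i j} (i∈U : i ∈ U) (j∈U : j ∈ U) → f i∈U ≡ f j∈U → i ≡ j) → ∣ U ∣ ≤ k
∣∣≤-injection []          f inj = z≤n
∣∣≤-injection (false ∷ U) f inj =
  ∣∣≤-injection U (f ∘ there) (λ i∈U j∈U eq → Fin.suc-injective (inj (there i∈U) (there j∈U) eq))
∣∣≤-injection {k = zero}  (true ∷ U) f inj with f here
... | ()
∣∣≤-injection {k = suc k} (true ∷ U) f inj = s≤s (∣∣≤-injection U f′ inj′)
  where
  f₀≢ : ∀ {i} (i∈U : i ∈ U) → f here ≢ f (there i∈U)
  f₀≢ i∈U eq = Fin.0≢1+n (inj here (there i∈U) eq)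
  f′ : ∀ {i} → i ∈ U → Fin k
  f′ i∈U = punchOut (f₀≢ i∈U)
  inj′ : ∀ {i j} (i∈U : i ∈ U) (j∈U : j ∈ U) → f′ i∈U ≡ f′ j∈U → i ≡ j
  inj′ i∈U j∈U eq =
    Fin.suc-injective (inj (there i∈U) (there j∈U) (Fin.punchOut-injective (f₀≢ i∈U) (f₀≢ j∈U) eq))

clique≤colours : ∀ {m k} (H : SimpleGraph m) {c : Fin m → Fin k} → IsProperColouring H k c →
  ∀ {U} → IsClique H U → ∣ U ∣ ≤ k
clique≤colours H {c} proper {U} clique = ∣∣≤-injection U (λ {i} _ → c i) injective
  where
  injective : ∀ {i j} → i ∈ U → j ∈ U → c i ≡ c j → i ≡ j
  injective {i} {j} i∈U j∈U ci≡cj with i ≟ j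
  ... | yes i≡j = i≡j
  ... | no  i≢j = contradiction ci≡cj (proper i j (clique i j i∈U j∈U i≢j))

Adj-complement : ∀ {n} (G : SimpleGraph n) {i j} →
  Adj (complement G) i j ⇔ (¬ Adj G i j × i ≢ j)
Adj-complement G {i} {j} with adj G i j | i ≟ j
... | true  | _       = mk⇔ (λ ())  (λ (¬adj , _) → contradiction refl ¬adj)
... | false | yes i≡j = mk⇔ (λ ())  (λ (_ , i≢j) → contradiction i≡j i≢j)
... | false | no  i≢j = mk⇔ (λ _ → (λ ()) , i≢j) (λ _ → refl)

Adj⇒≢ : ∀ {n} (G : SimpleGraph n) {i j} → Adj G i j → i ≢ j
Adj⇒≢ G {i} adj refl = contradiction (trans (sym adj) (irrefl G i)) λ ()

stable⇒complement-clique : ∀ {n} (G : SimpleGraph n) {U} → IsStable G U → IsClique (complement G) U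
stable⇒complement-clique G stable i j i∈U j∈U i≢j =
  from (Adj-complement G) (stable i j i∈U j∈U , i≢j)

complement-clique⇒stable : ∀ {n} (G : SimpleGraph n) {U} → IsClique (complement G) U → IsStable G U
complement-clique⇒stable G clique i j i∈U j∈U adj =
  proj₁ (to (Adj-complement G) (clique i j i∈U j∈U (Adj⇒≢ G adj))) adj

fromDecidable : ∀ {n} (E : Fin n → Fin n → Set) → (∀ u v → Dec (E u v)) →
  (∀ {u v} → E u v → E v u) → (∀ {u} → ¬ E u u) → SimpleGraph n
fromDecidable E E? E-sym E-irrefl = record
  { adj     = λ u v → does (E? u v)
  ; adj-sym = λ u v → does-⇔ (mk⇔ (E-sym {u} {v}) (E-sym {v} {u})) (E? u v) (E? v u)
  ; irrefl  = λ u → dec-false (E? u u) E-irrefl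
  }

Adj-fromDecidable : ∀ {n} {E : Fin n → Fin n → Set} (E? : ∀ u v → Dec (E u v))
  (E-sym : ∀ {u v} → E u v → E v u) (E-irrefl : ∀ {u} → ¬ E u u) {u v} →
  Adj (fromDecidable E E? E-sym E-irrefl) u v ⇔ E u v
Adj-fromDecidable E? _ _ {u} {v} with E? u v
... | yes e  = mk⇔ (λ _ → e) (λ _ → refl)
... | no  ¬e = mk⇔ (λ ()) (λ e → contradiction e ¬e)

-- An edge weighs more than t.  A stable set meets C in at most one vertex c, and its
-- other (at most n) vertices have δ ≤ κ c, so together they weigh at most n B^(κ c) < B^(κ c + 1).
module SplitThreshold {n : ℕ} (T : SimpleGraph n)
  (C : Fin n → Set) (C? : ∀ u → Dec (C u)) (κ δ : Fin n → ℕ) (K : ℕ)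
  (κ≤K : ∀ u → κ u ≤ K) (δ≤K : ∀ u → δ u ≤ K)
  (C-clique : ∀ {c c′} → C c → C c′ → c ≢ c′ → Adj T c c′)
  (∁C-stable : ∀ {u v} → ¬ C u → ¬ C v → ¬ Adj T u v)
  (cross : ∀ {c v} → C c → ¬ C v → Adj T c v ⇔ κ c < δ v)
  where

  B : ℕ
  B = 2 + n

  Q : ℕ
  Q = B ^ suc K

  t : ℕ
  t = B * Q

  weight : Fin n → ℕ
  weight u = if does (C? u) then suc t ∸ B ^ suc (κ u) else B ^ δ u

  B^suc-κ≤Q : ∀ c → B ^ suc (κ c) ≤ Q
  B^suc-κ≤Q c = ℕ.^-monoʳ-≤ B (s≤s (κ≤K c))

  Q≤t : Q ≤ t
  Q≤t = ℕ.m≤m+n Q _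

  weight-C : ∀ {c} → C c → weight c + B ^ suc (κ c) ≡ suc t
  weight-C {c} Cc with C? c
  ... | yes _  = ℕ.m∸n+n≡m (ℕ.≤-trans (B^suc-κ≤Q c) (ℕ.m≤n⇒m≤1+n Q≤t))
  ... | no ¬Cc = contradiction Cc ¬Cc

  weight-∁C : ∀ {v} → ¬ C v → weight v ≡ B ^ δ v
  weight-∁C {v} ¬Cv with C? v
  ... | yes Cv = contradiction Cv ¬Cv
  ... | no  _  = refl

  Q≤weight-C : ∀ {c} → C c → Q ≤ weight c
  Q≤weight-C {c} Cc = ℕ.+-cancelʳ-≤ Q Q (weight c) (begin
    Q + Q                      ≤⟨ ℕ.+-monoʳ-≤ Q (ℕ.m≤m+n Q _) ⟩
    t                          ≤⟨ ℕ.n≤1+n t ⟩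
    suc t                      ≡⟨ weight-C Cc ⟨
    weight c + B ^ suc (κ c)   ≤⟨ ℕ.+-monoʳ-≤ (weight c) (B^suc-κ≤Q c) ⟩
    weight c + Q               ∎)
    where open ℕ.≤-Reasoning

  cross-heavy : ∀ {c v} → C c → ¬ C v → Adj T c v → suc t ≤ weight c + weight v
  cross-heavy {c} {v} Cc ¬Cv adj = begin
    suc t                      ≡⟨ weight-C Cc ⟨
    weight c + B ^ suc (κ c)   ≤⟨ ℕ.+-monoʳ-≤ (weight c) (ℕ.^-monoʳ-≤ B (to (cross Cc ¬Cv) adj)) ⟩
    weight c + B ^ δ v         ≡⟨ cong (weight c +_) (weight-∁C ¬Cv) ⟨
    weight c + weight v        ∎
    where open ℕ.≤-Reasoning

  C-pair-heavy : ∀ {i j} → C i → C j → suc t ≤ weight i + weight j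
  C-pair-heavy {i} {j} Ci Cj = begin
    suc t                      ≡⟨ weight-C Ci ⟨
    weight i + B ^ suc (κ i)   ≤⟨ ℕ.+-monoʳ-≤ (weight i) (B^suc-κ≤Q i) ⟩
    weight i + Q               ≤⟨ ℕ.+-monoʳ-≤ (weight i) (Q≤weight-C Cj) ⟩
    weight i + weight j        ∎
    where open ℕ.≤-Reasoning

  edge-heavy : ∀ {i j} → Adj T i j → suc t ≤ weight i + weight j
  edge-heavy {i} {j} adj = by-cases (C? i) (C? j)
    where
    by-cases : Dec (C i) → Dec (C j) → suc t ≤ weight i + weight j
    by-cases (yes Ci) (yes Cj) = C-pair-heavy Ci Cj
    by-cases (yes Ci) (no ¬Cj) = cross-heavy Ci ¬Cj adj
    by-cases (no ¬Ci) (yes Cj) = subst (suc t ≤_) (ℕ.+-comm (weight j) (weight i))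
                                   (cross-heavy Cj ¬Ci (trans (adj-sym T j i) adj))
    by-cases (no ¬Ci) (no ¬Cj) = contradiction adj (∁C-stable ¬Ci ¬Cj)

  stable-light : ∀ {U} → IsStable T U → sumℕ weight U ≤ t
  stable-light {U} stable with Fin.any? (λ c → (c ∈? U) ×-dec C? c)
  ... | yes (c , c∈U , Cc) = ℕ.≤-pred (begin-strict
    sumℕ weight U            ≤⟨ sum≤member+card*bound weight U c∈U below-c ⟩
    weight c + n * B ^ κ c   <⟨ ℕ.+-monoʳ-< (weight c) n*P<B*P ⟩
    weight c + B ^ suc (κ c) ≡⟨ weight-C Cc ⟩
    suc t                    ∎)
    where
    open ℕ.≤-Reasoning
    n*P<B*P : n * B ^ κ c < B * B ^ κ c
    n*P<B*P = ℕ.*-monoˡ-< (B ^ κ c) {{ℕ.m^n≢0 B (κ c)}} (ℕ.m≤n⇒m≤1+n (ℕ.n<1+n n))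
    below-c : ∀ {i} → i ∈ U → i ≢ c → weight i ≤ B ^ κ c
    below-c {i} i∈U i≢c = begin
      weight i   ≡⟨ weight-∁C ¬Ci ⟩
      B ^ δ i    ≤⟨ ℕ.^-monoʳ-≤ B (ℕ.≮⇒≥ λ κc<δi → stable c i c∈U i∈U (from (cross Cc ¬Ci) κc<δi)) ⟩
      B ^ κ c    ∎
      where
      ¬Ci : ¬ C i
      ¬Ci Ci = stable c i c∈U i∈U (C-clique Cc Ci (i≢c ∘ sym))
  ... | no no-C = ℕ.≤-trans (sum≤card*bound weight U below-Q) (ℕ.≤-trans (ℕ.m≤n+m _ Q) (ℕ.m≤n+m _ Q))
    where
    below-Q : ∀ {i} → i ∈ U → weight i ≤ Q
    below-Q {i} i∈U = begin
      weight i   ≡⟨ weight-∁C (λ Ci → no-C (i , i∈U , Ci)) ⟩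
      B ^ δ i    ≤⟨ ℕ.^-monoʳ-≤ B (ℕ.m≤n⇒m≤1+n (δ≤K i)) ⟩
      Q          ∎
      where open ℕ.≤-Reasoning

  threshold : IsThreshold T
  threshold = fromℕ ∘ weight , fromℕ t , fromℕ-nonNeg ∘ weight , fromℕ-nonNeg t ,
              λ U → mk⇔ light⇒stable (λ stable → subst (ℚ._≤ fromℕ t) (sym (sumOver-fromℕ weight U))
                                                           (fromℕ-mono-≤ (stable-light stable)))
    where
    light⇒stable : ∀ {U} → sumOver (fromℕ ∘ weight) U ℚ.≤ fromℕ t → IsStable T U
    light⇒stable {U} light i j i∈U j∈U adj = ℕ.<⇒≱
      (ℕ.≤-trans (edge-heavy adj) (pair≤sum weight U i∈U j∈U (Adj⇒≢ T adj)))
      (fromℕ-cancel-≤ (subst (ℚ._≤ fromℕ t) (sumOver-fromℕ weight U) light))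

Inverted : ∀ {n} (p x : Fin n → ℕ) → Fin n → Fin n → Set
Inverted p x i j = p i < p j × x j < x i

module InversionGraph {n : ℕ} (G : SimpleGraph n) (p x : Fin n → ℕ)
  (p-injective : ∀ {i j} → p i ≡ p j → i ≡ j) (x-injective : ∀ {i j} → x i ≡ x j → i ≡ j)
  (p<n : ∀ u → p u < n)
  (Adj⇔inverted : ∀ {i j} → Adj G i j ⇔ (Inverted p x i j ⊎ Inverted p x j i))
  where

  _≺_ : Fin n → Fin n → Set
  i ≺ j = p i < p j × x i < x j

  _≺?_ : ∀ i j → Dec (i ≺ j)
  i ≺? j = (p i <? p j) ×-dec (x i <? x j)

  ≺-trans : ∀ {i j k} → i ≺ j → j ≺ k → i ≺ k
  ≺-trans (pi<pj , xi<xj) (pj<pk , xj<xk) = ℕ.<-trans pi<pj pj<pk , ℕ.<-trans xi<xj xj<xk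

  ≺-irrefl : ∀ {i} → ¬ i ≺ i
  ≺-irrefl (pi<pi , _) = ℕ.<-irrefl refl pi<pi

  ≺⇒¬Adj : ∀ {i j} → i ≺ j → ¬ Adj G i j
  ≺⇒¬Adj (pi<pj , xi<xj) adj with to Adj⇔inverted adj
  ... | inj₁ (_ , xj<xi) = ℕ.<-asym xi<xj xj<xi
  ... | inj₂ (pj<pi , _) = ℕ.<-asym pi<pj pj<pi

  ≺⇒Adjᶜ : ∀ {i j} → i ≺ j → Adj (complement G) i j
  ≺⇒Adjᶜ i≺j = from (Adj-complement G) (≺⇒¬Adj i≺j , λ { refl → ≺-irrefl i≺j })

  p-distinct : ∀ {i j} → i ≢ j → p i < p j ⊎ p j < p i
  p-distinct {i} {j} i≢j with ℕ.<-cmp (p i) (p j)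
  ... | tri< pi<pj _ _ = inj₁ pi<pj
  ... | tri≈ _ pi≡pj _ = contradiction (p-injective pi≡pj) i≢j
  ... | tri> _ _ pj<pi = inj₂ pj<pi

  incomparable⇒Adj : ∀ {i j} → i ≢ j → ¬ i ≺ j → ¬ j ≺ i → Adj G i j
  incomparable⇒Adj {i} {j} i≢j i⊀j j⊀i with p-distinct i≢j | ℕ.<-cmp (x i) (x j)
  ... | _           | tri≈ _ xi≡xj _ = contradiction (x-injective xi≡xj) i≢j
  ... | inj₁ pi<pj | tri< xi<xj _ _ = contradiction (pi<pj , xi<xj) i⊀j
  ... | inj₁ pi<pj | tri> _ _ xj<xi = from Adj⇔inverted (inj₁ (pi<pj , xj<xi))
  ... | inj₂ pj<pi | tri< xi<xj _ _ = from Adj⇔inverted (inj₂ (pj<pi , xi<xj))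
  ... | inj₂ pj<pi | tri> _ _ xj<xi = contradiction (pj<pi , xj<xi) j⊀i

  -- `levelWithin f u` is the longest ≺-chain below u, computed with recursion depth f;
  -- depth p u + 1 already suffices, since p strictly decreases along ≺.
  levelWithin : ℕ → Fin n → ℕ
  levelWithin zero    _ = 0
  levelWithin (suc f) u = maxOver λ v → if does (v ≺? u) then suc (levelWithin f v) else 0

  levelWithin-depth : ∀ f g {u} → p u < f → p u < g → levelWithin f u ≡ levelWithin g u
  levelWithin-depth (suc f) (suc g) {u} pu<f pu<g = maxOver-cong λ v → if-does-cong (v ≺? u)
    λ (pv<pu , _) → cong suc (levelWithin-depth f g (ℕ.<-≤-trans pv<pu (ℕ.≤-pred pu<f))
                                                     (ℕ.<-≤-trans pv<pu (ℕ.≤-pred pu<g)))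

  level : Fin n → ℕ
  level = levelWithin n

  levelVia : Fin n → Fin n → ℕ
  levelVia u v = if does (v ≺? u) then suc (level v) else 0

  level-unfold : ∀ u → level u ≡ maxOver (levelVia u)
  level-unfold u = unfold n (p<n u)
    where
    unfold : ∀ f → p u < f → levelWithin f u ≡ maxOver (levelVia u)
    unfold (suc f) pu<f = maxOver-cong λ v → if-does-cong (v ≺? u)
      λ (pv<pu , _) → cong suc (levelWithin-depth f n (ℕ.<-≤-trans pv<pu (ℕ.≤-pred pu<f)) (p<n v))

  ≺⇒level< : ∀ {v u} → v ≺ u → level v < level u
  ≺⇒level< {v} {u} v≺u = begin-strict
    level v              <⟨ ℕ.n<1+n (level v) ⟩
    suc (level v)        ≡⟨ if-does-yes (v ≺? u) v≺u ⟨
    levelVia u v         ≤⟨ ≤-maxOver (levelVia u) v ⟩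
    maxOver (levelVia u) ≡⟨ level-unfold u ⟨
    level u              ∎
    where open ℕ.≤-Reasoning

  level-predecessor : ∀ {u k} → level u ≡ suc k → ∃ λ v → v ≺ u × level v ≡ k
  level-predecessor {u} lu≡ with maxOver-attained (levelVia u) (trans (sym (level-unfold u)) lu≡)
  ... | v , via≡ with if-does-≡suc (v ≺? u) via≡
  ...   | v≺u , slv≡ = v , v≺u , ℕ.suc-injective slv≡

  same-level⇒Adj : ∀ {i j} → i ≢ j → level i ≡ level j → Adj G i j
  same-level⇒Adj i≢j li≡lj = incomparable⇒Adj i≢j
    (λ i≺j → ℕ.<-irrefl li≡lj (≺⇒level< i≺j)) (λ j≺i → ℕ.<-irrefl (sym li≡lj) (≺⇒level< j≺i))

  chain-up-to : ∀ {k} u → level u ≡ k → ∃ λ U →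
    IsClique (complement G) U × (∀ {w} → w ∈ U → w ≡ u ⊎ w ≺ u) × suc k ≤ ∣ U ∣
  chain-up-to {zero} u _ = ⁅ u ⁆ , singleton-clique , inj₁ ∘ x∈⁅y⁆⇒x≡y u , ℕ.≤-reflexive (sym (∣⁅x⁆∣≡1 u))
    where
    singleton-clique : IsClique (complement G) ⁅ u ⁆
    singleton-clique i j i∈ j∈ i≢j = contradiction (trans (x∈⁅y⁆⇒x≡y u i∈) (sym (x∈⁅y⁆⇒x≡y u j∈))) i≢j
  chain-up-to {suc k} u lu≡ with level-predecessor lu≡
  ... | v , v≺u , lv≡k with chain-up-to v lv≡k
  ...   | U , clique , up-to-v , size = U ∪ ⁅ u ⁆ , clique′ , up-to-u ,
          ℕ.≤-trans (s≤s size) (p⊂q⇒∣p∣<∣q∣ U⊂U∪u)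
    where
    below-u : ∀ {w} → w ∈ U → w ≺ u
    below-u w∈U = [ (λ { refl → v≺u }) , (λ w≺v → ≺-trans w≺v v≺u) ] (up-to-v w∈U)
    U⊂U∪u : U ⊂ U ∪ ⁅ u ⁆
    U⊂U∪u = p⊆p∪q ⁅ u ⁆ , u , x∈p∪q⁺ (inj₂ (x∈⁅x⁆ u)) , ≺-irrefl ∘ below-u
    members : ∀ {w} → w ∈ U ∪ ⁅ u ⁆ → w ∈ U ⊎ w ≡ u
    members w∈ = map₂ (x∈⁅y⁆⇒x≡y u) (x∈p∪q⁻ U ⁅ u ⁆ w∈)
    up-to-u : ∀ {w} → w ∈ U ∪ ⁅ u ⁆ → w ≡ u ⊎ w ≺ u
    up-to-u w∈ = [ inj₂ ∘ below-u , inj₁ ] (members w∈)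
    clique′ : IsClique (complement G) (U ∪ ⁅ u ⁆)
    clique′ i j i∈ j∈ i≢j with members i∈ | members j∈
    ... | inj₁ i∈U | inj₁ j∈U = clique i j i∈U j∈U i≢j
    ... | inj₁ i∈U | inj₂ refl = ≺⇒Adjᶜ (below-u i∈U)
    ... | inj₂ refl | inj₁ j∈U = trans (adj-sym (complement G) i j) (≺⇒Adjᶜ (below-u j∈U))
    ... | inj₂ refl | inj₂ refl = contradiction refl i≢j

  levels : ℕ
  levels = maxOver (suc ∘ level)

  colouring : Fin n → Fin levels
  colouring u = fromℕ< (≤-maxOver (suc ∘ level) u)

  toℕ-colouring : ∀ u → toℕ (colouring u) ≡ level u
  toℕ-colouring u = Fin.toℕ-fromℕ< _

  colouring-proper : IsProperColouring (complement G) levels colouring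
  colouring-proper i j adjᶜ ci≡cj with to (Adj-complement G) adjᶜ
  ... | ¬adj , i≢j = ¬adj (same-level⇒Adj i≢j
        (trans (sym (toℕ-colouring i)) (trans (cong toℕ ci≡cj) (toℕ-colouring j))))

  longest-chain : ∃ λ U → IsClique (complement G) U × levels ≤ ∣ U ∣
  longest-chain with levels in levels≡
  ... | zero  = ⊥ , (λ i j i∈⊥ → contradiction i∈⊥ ∉⊥) , z≤n
  ... | suc k with maxOver-attained (suc ∘ level) levels≡
  ...   | u , slu≡ with chain-up-to u refl
  ...     | U , clique , _ , size = U , clique , subst (_≤ ∣ U ∣) slu≡ size

  OnLevel : Fin levels → Fin n → Set
  OnLevel l u = level u ≡ toℕ l

  OnLevel? : ∀ l u → Dec (OnLevel l u)
  OnLevel? l u = level u ℕ.≟ toℕ l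

  LayerEdge : Fin levels → Fin n → Fin n → Set
  LayerEdge l u v = Adj G u v × (p u < p v × OnLevel l u ⊎ p v < p u × OnLevel l v)

  LayerEdge? : ∀ l u v → Dec (LayerEdge l u v)
  LayerEdge? l u v = (adj G u v Bool.≟ true)
    ×-dec (((p u <? p v) ×-dec OnLevel? l u) ⊎-dec ((p v <? p u) ×-dec OnLevel? l v))

  LayerEdge-sym : ∀ {l u v} → LayerEdge l u v → LayerEdge l v u
  LayerEdge-sym {u = u} {v} (adj , lower) = trans (adj-sym G v u) adj , swap lower

  LayerEdge-irrefl : ∀ {l u} → ¬ LayerEdge l u u
  LayerEdge-irrefl (adj , _) = Adj⇒≢ G adj refl

  layer : Fin levels → SimpleGraph n
  layer l = fromDecidable (LayerEdge l) (LayerEdge? l) LayerEdge-sym LayerEdge-irrefl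

  Adj-layer : ∀ {l u v} → Adj (layer l) u v ⇔ LayerEdge l u v
  Adj-layer {l} = Adj-fromDecidable (LayerEdge? l) LayerEdge-sym LayerEdge-irrefl

  -- In a layer the level is a clique, the rest is stable, and a level vertex c sees an off-level
  -- v iff p c < p v and x v < x c.  The level is a ≺-antichain, so x decreases along it as p
  -- increases; hence the second condition reads p c < reach v, and the neighbourhoods are nested.
  module Layer (l : Fin levels) where

    reach : Fin n → ℕ
    reach v = maxOver λ c → if does (OnLevel? l c ×-dec x v <? x c) then suc (p c) else 0

    <reach⇒ : ∀ {c v} → OnLevel l c → p c < reach v → x v < x c
    <reach⇒ {c} {v} c-on pc<reach with reach v in reach≡ | pc<reach
    ... | suc m | s≤s pc≤m with maxOver-attained _ reach≡
    ...   | c′ , term≡ with if-does-≡suc (OnLevel? l c′ ×-dec x v <? x c′) term≡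
    ...     | (c′-on , xv<xc′) , spc′≡ with c ≟ c′
    ...       | yes refl = xv<xc′
    ...       | no  c≢c′ with to Adj⇔inverted (same-level⇒Adj c≢c′ (trans c-on (sym c′-on)))
    ...         | inj₁ (_ , xc′<xc) = ℕ.<-trans xv<xc′ xc′<xc
    ...         | inj₂ (pc′<pc , _) = contradiction pc′<pc
                    (ℕ.≤⇒≯ (subst (p c ≤_) (ℕ.suc-injective (sym spc′≡)) pc≤m))

    <reach⇐ : ∀ {c v} → OnLevel l c → x v < x c → p c < reach v
    <reach⇐ {c} {v} c-on xv<xc = subst (_≤ reach v)
      (if-does-yes (OnLevel? l c ×-dec x v <? x c) (c-on , xv<xc)) (≤-maxOver _ c)

    δ : Fin n → ℕ
    δ v = p v ⊓ reach v

    cross : ∀ {c v} → OnLevel l c → ¬ OnLevel l v → Adj (layer l) c v ⇔ p c < δ v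
    cross {c} {v} c-on ¬v-on = mk⇔ edge⇒ ⇒edge
      where
      edge⇒ : Adj (layer l) c v → p c < δ v
      edge⇒ adjₗ with to Adj-layer adjₗ
      ... | _   , inj₂ (_ , v-on)  = contradiction v-on ¬v-on
      ... | adj , inj₁ (pc<pv , _) with to Adj⇔inverted adj
      ...   | inj₁ (_ , xv<xc)  = ℕ.⊓-glb pc<pv (<reach⇐ c-on xv<xc)
      ...   | inj₂ (pv<pc , _)  = contradiction pc<pv (ℕ.<-asym pv<pc)
      ⇒edge : p c < δ v → Adj (layer l) c v
      ⇒edge pc<δv = from Adj-layer (from Adj⇔inverted (inj₁ (pc<pv , xv<xc)) , inj₁ (pc<pv , c-on))
        where
        pc<pv = ℕ.m<n⊓o⇒m<n (p v) (reach v) pc<δv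
        xv<xc = <reach⇒ c-on (ℕ.m<n⊓o⇒m<o (p v) (reach v) pc<δv)

    level-clique : ∀ {c c′} → OnLevel l c → OnLevel l c′ → c ≢ c′ → Adj (layer l) c c′
    level-clique c-on c′-on c≢c′ = from Adj-layer (same-level⇒Adj c≢c′ (trans c-on (sym c′-on)) ,
      [ (λ pc<pc′ → inj₁ (pc<pc′ , c-on)) , (λ pc′<pc → inj₂ (pc′<pc , c′-on)) ] (p-distinct c≢c′))

    off-level-stable : ∀ {u v} → ¬ OnLevel l u → ¬ OnLevel l v → ¬ Adj (layer l) u v
    off-level-stable ¬u-on ¬v-on adjₗ = [ ¬u-on ∘ proj₂ , ¬v-on ∘ proj₂ ] (proj₂ (to Adj-layer adjₗ))

    threshold : IsThreshold (layer l)
    threshold = SplitThreshold.threshold (layer l) (OnLevel l) (OnLevel? l) p δ n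
      (ℕ.<⇒≤ ∘ p<n) (λ v → ℕ.≤-trans (ℕ.m⊓n≤m (p v) (reach v)) (ℕ.<⇒≤ (p<n v)))
      level-clique off-level-stable cross

  layers-cover : IsThresholdCover G levels layer
  layers-cover = Layer.threshold , λ i j → mk⇔ covering-layer (λ (_ , adjₗ) → proj₁ (to Adj-layer adjₗ))
    where
    covering-layer : ∀ {i j} → Adj G i j → ∃ λ l → Adj (layer l) i j
    covering-layer {i} {j} adj with p-distinct (Adj⇒≢ G adj)
    ... | inj₁ pi<pj = colouring i , from Adj-layer (adj , inj₁ (pi<pj , sym (toℕ-colouring i)))
    ... | inj₂ pj<pi = colouring j , from Adj-layer (adj , inj₂ (pj<pi , sym (toℕ-colouring j)))

coordinate : ∀ {n} → Permutation′ n → Fin n → ℕ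
coordinate π u = toℕ (π ⟨$⟩ʳ u)

coordinate-injective : ∀ {n} (π : Permutation′ n) {i j} → coordinate π i ≡ coordinate π j → i ≡ j
coordinate-injective π = Injection.injective (↔⇒↣ π) ∘ Fin.toℕ-injective

<ᵇ⇔< : ∀ {a b} → T (a <ᵇ b) ⇔ a < b
<ᵇ⇔< {a} {b} = mk⇔ (ℕ.<ᵇ⇒< a b) ℕ.<⇒<ᵇ

T-<ᵇ∧<ᵇ : ∀ {a b c d} → T ((a <ᵇ b) ∧ (c <ᵇ d)) ⇔ (a < b × c < d)
T-<ᵇ∧<ᵇ = (<ᵇ⇔< ×-⇔ <ᵇ⇔<) ⇔-∘ Bool.T-∧

inversion-reflects : ∀ {a b c d} →
  (((a <ᵇ b) ∧ (d <ᵇ c)) ∨ ((b <ᵇ a) ∧ (c <ᵇ d))) ≡ true ⇔ (a < b × d < c ⊎ b < a × c < d)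
inversion-reflects = ((T-<ᵇ∧<ᵇ ⊎-⇔ T-<ᵇ∧<ᵇ) ⇔-∘ Bool.T-∨) ⇔-∘ ⇔-sym Bool.T-≡

permutationGraph-inversions : ∀ {n} {G : SimpleGraph n} {Π σ : Permutation′ n} →
  (∀ i j → adj G i j ≡ permAdj Π (σ ⟨$⟩ʳ i) (σ ⟨$⟩ʳ j)) → ∀ {i j} →
  Adj G i j ⇔ (Inverted (coordinate σ) (coordinate (σ ∘ₚ flip Π)) i j
              ⊎ Inverted (coordinate σ) (coordinate (σ ∘ₚ flip Π)) j i)
permutationGraph-inversions adj≡ {i} {j} =
  inversion-reflects ⇔-∘ mk⇔ (trans (sym (adj≡ i j))) (trans (adj≡ i j))

theorem4 : ∀ (n : ℕ) (G : SimpleGraph n) → IsPermutationGraph G →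
    ∃ λ a → ThresholdDimensionAtMost G a
    × IsChromaticNumber (complement G) a
    × IsCliqueNumber (complement G) a
    × IsIndependenceNumber G a
theorem4 n G (Π , σ , adj≡) =
  levels , (levels , ℕ.≤-refl , layer , layers-cover)
  , ((colouring , colouring-proper)
    , λ k c proper → ℕ.≤-trans chain-long (clique≤colours (complement G) proper chain-clique))
  , ((chain , chain-clique , chain-size) , λ U → clique≤colours (complement G) colouring-proper)
  , ((chain , complement-clique⇒stable G chain-clique , chain-size)
    , λ U → clique≤colours (complement G) colouring-proper ∘ stable⇒complement-clique G)
  where
  open InversionGraph G (coordinate σ) (coordinate (σ ∘ₚ flip Π))
    (coordinate-injective σ) (coordinate-injective (σ ∘ₚ flip Π)) (Fin.toℕ<n ∘ (σ ⟨$⟩ʳ_))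
    (permutationGraph-inversions {G = G} {Π} {σ} adj≡)
  chain : Subset n
  chain = proj₁ longest-chain
  chain-clique : IsClique (complement G) chain
  chain-clique = proj₁ (proj₂ longest-chain)
  chain-long : levels ≤ ∣ chain ∣
  chain-long = proj₂ (proj₂ longest-chain)
  chain-size : ∣ chain ∣ ≡ levels
  chain-size = ℕ.≤-antisym (clique≤colours (complement G) colouring-proper chain-clique) chain-long
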